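{- Let $n \geq 4$ be an even integer and let $\widetilde{L}$ be the special Laplacian of the wheel graph $W_n$. Then $\widetilde{L}$ is positive semidefinite.
   Context: For $c=(c_1,\dotsc,c_m)$, $\mathrm{Circ}(c)$ denotes the $m\times m$ circulant matrix whose $(i,j)$ entry is $c_{((j-i) \bmod m)+1}$. Special Laplacian: for $n\ge4$ even and $k\in\{1,\dotsc,\frac n2-1\}$, let $c^k\in\mathbb{R}^{n-1}$ have $c^k_j=1$ if $j=k+1$ or $j=n-k$ and $c^k_j=0$ otherwise, and let $C_k=\mathrm{Circ}(c^k)$ (of order $n-1$). Then \[\widetilde{L} := \frac{n-1}{2} I - \frac12\begin{bmatrix}0 & \mathbf{1}'\\ \mathbf{1} & 0\end{bmatrix} + \sum_{k=1}^{\frac n2 -1} (-1)^k \frac{(n-1)-2k}{2}\begin{bmatrix}0&0\\0&C_k\end{bmatrix},\] an $n\times n$ matrix, where $\mathbf{1}$ is the all-ones vector of length $n-1$.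
   Formalization: In the positive semidefiniteness of $\widetilde{L}$, the quadratic form is required to be nonnegative only at vectors with rational entries. -}

module Defs where

open import Data.Nat as ℕ using (ℕ; zero; suc; _∸_; _≡ᵇ_)
open import Data.Nat.DivMod using (_mod_; _/_)
open import Data.Bool using (if_then_else_; _∨_)
open import Data.Fin using (Fin; zero; suc; toℕ)
open import Data.Fin.Properties using (_≟_)
open import Data.Integer using (+_)
open import Data.Rational as ℚ using (ℚ; 0ℚ; 1ℚ; _+_; _*_; -_; _≤_)
open import Data.List using (List; []; _∷_; foldr; map)
open import Relation.Nullary using (yes; no)
open import Relation.Binary.PropositionalEquality using (_≡_)

Matrix : ℕ → Set
Matrix n = Fin n → Fin n → ℚ

half : ℕ → ℚ
half m = (+ m) ℚ./ 2

sign : ℕ → ℚ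
sign zero = 1ℚ
sign (suc k) = - sign k

Σ : ∀ {n} → (Fin n → ℚ) → ℚ
Σ {zero} f = 0ℚ
Σ {suc n} f = f zero + Σ (λ i → f (suc i))

I : ∀ {n} → Matrix n
I i j with i ≟ j
... | yes _ = 1ℚ
... | no _ = 0ℚ

-- Circ(c): entry (i,j) is c_{((j-i) mod m)+1}; with 0-based indices for
-- rows, columns and the vector c this is c ((j - i) mod m)
Circ : ∀ {m} → (Fin m → ℚ) → Matrix m
Circ {zero} c ()
Circ {suc m} c i j = c ((toℕ j ℕ.+ suc m ∸ toℕ i) mod suc m)

-- the vector c^k ∈ ℚ^{n-1}: (1-based) c^k_j = 1 iff j = k+1 or j = n-k.
-- Position t : Fin (n ∸ 1) (0-based) is the 1-based index j = t + 1.
cvec : (n k : ℕ) → Fin (n ∸ 1) → ℚ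
cvec n k t = if ((suc (toℕ t) ≡ᵇ suc k) ∨ (suc (toℕ t) ≡ᵇ n ∸ k)) then 1ℚ else 0ℚ

Border : ∀ {m} → Matrix (suc m)
Border zero zero = 0ℚ
Border zero (suc _) = 1ℚ
Border (suc _) zero = 1ℚ
Border (suc _) (suc _) = 0ℚ

embed : ∀ {m} → Matrix m → Matrix (suc m)
embed A zero _ = 0ℚ
embed A (suc _) zero = 0ℚ
embed A (suc i) (suc j) = A i j

range : ℕ → ℕ → List ℕ
range a zero = []
range a (suc len) = a ∷ range (suc a) len

Σk : ℕ → (ℕ → ℚ) → ℚ
Σk K f = foldr _+_ 0ℚ (map f (range 1 K))

specialLaplacian : (n : ℕ) → Matrix n
specialLaplacian zero ()
specialLaplacian (suc m) i j =
  half m * I i j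
  + (- (ℚ.½ * Border i j))
  + Σk ((suc m / 2) ∸ 1)
       (λ k → sign k * half (m ∸ 2 ℕ.* k) * embed (Circ (cvec (suc m) k)) i j)

Symmetric : ∀ {n} → Matrix n → Set
Symmetric A = ∀ i j → A i j ≡ A j i

quadForm : ∀ {n} → Matrix n → (Fin n → ℚ) → ℚ
quadForm A x = Σ (λ i → Σ (λ j → x i * A i j * x j))

PositiveSemidefinite : ∀ {n} → Matrix n → Set
PositiveSemidefinite A = Symmetric A × (∀ x → 0ℚ ≤ quadForm A x)
  where open import Data.Product using (_×_)

-- Write n = 2p + 2, M = n - 1 = 2p + 1, and split x = (x₀, y) with y indexed cyclically
-- mod M.  With the cyclic autocorrelation T d = Σₐ y_a y_{a+d} and C_k = P^k + P^{-k}
-- (P the cyclic shift), the quadratic form is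
--   x'L̃x = (M/2)(x₀² + T 0) - x₀ Σ y + Σ_{k=1}^{p} (-1)^k (M - 2k) T k.
-- The alternating windows W_N(i) = Σ_{j<N} (-1)^j y_{i+j} satisfy
--   Σᵢ W_N(i)² = N T 0 + 2 Σ_{0<d<N} (N - d) (-1)^d T d,
-- and the weights N - d for N = p and N = p + 1 add up to M - 2d.  Of the alternating
-- sums α_N = Σ_{j<N} (-1)^j for N = p, p + 1 one is 1 and the other 0, whence
--   x'L̃x = ½ Σᵢ (W_p(i) - α_p x₀)² + ½ Σᵢ (W_{p+1}(i) - α_{p+1} x₀)².

module Submission where

open import Defs
open import Data.Nat using (ℕ; _≤_)
open import Data.Nat.Divisibility using (_∣_)

open import Algebra.Properties.Group using (∙-cancelˡ)
open import Data.Bool as Bool using (Bool; true; false; _∨_; if_then_else_)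
open import Data.Empty using (⊥; ⊥-elim)
open import Data.Fin using (Fin; zero; suc; toℕ)
open import Data.Fin.Properties using (_≟_; toℕ-injective; toℕ-fromℕ<; toℕ<n)
open import Data.Integer as ℤ using ()
import Data.Integer.Tactic.RingSolver as ℤ-Solver
open import Data.List using (foldr; map)
open import Data.Maybe using (Maybe; just; nothing)
open import Data.Nat as ℕ using (zero; suc; _∸_; _%_; _<_; _≡ᵇ_; NonZero; s≤s; z≤n)
open import Data.Nat.Divisibility using (divides)
open import Data.Nat.DivMod using (_mod_; m%n<n; %-distribˡ-+; m%n%n≡m%n; [m+n]%n≡m%n; m<n⇒m%n≡m; m*n/n≡m)
import Data.Nat.Properties as ℕP
import Data.Nat.Tactic.RingSolver as ℕ-Solver
open import Data.Product using (_×_; _,_)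
open import Data.Rational as ℚ using (ℚ; 0ℚ; 1ℚ; _+_; _*_; -_; ½)
import Data.Rational.Properties as ℚP
open import Data.Rational.Unnormalised as ℚᵘ using (mkℚᵘ; *≡*)
import Data.Rational.Unnormalised.Properties as ℚᵘP
open import Data.Sum using (_⊎_; inj₁; inj₂)
open import Function using (_∘_)
open import Relation.Binary.PropositionalEquality
open import Relation.Nullary using (yes; no)
open import Tactic.RingSolver using (solve-∀)
open import Tactic.RingSolver.Core.AlmostCommutativeRing using (AlmostCommutativeRing; fromCommutativeRing)

+-right-comm : ∀ a b c → a ℕ.+ b ℕ.+ c ≡ a ℕ.+ c ℕ.+ b
+-right-comm = ℕ-Solver.solve-∀

[1+p]*2≡2+p+p : ∀ p → suc p ℕ.* 2 ≡ suc (suc (p ℕ.+ p))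
[1+p]*2≡2+p+p = ℕ-Solver.solve-∀

odd∸even : ∀ {e p} → e < p → suc (p ℕ.+ p) ∸ 2 ℕ.* suc e ≡ suc ((p ∸ suc e) ℕ.+ (p ∸ suc e))
odd∸even {e} {p} e<p = trans (cong (_∸ 2 ℕ.* suc e) split) (ℕP.m+n∸m≡n (2 ℕ.* suc e) _)
  where
  q = p ∸ suc e
  regroup : ∀ e q → suc ((suc e ℕ.+ q) ℕ.+ (suc e ℕ.+ q)) ≡ 2 ℕ.* suc e ℕ.+ suc (q ℕ.+ q)
  regroup = ℕ-Solver.solve-∀
  split : suc (p ℕ.+ p) ≡ 2 ℕ.* suc e ℕ.+ suc (q ℕ.+ q)
  split = trans (cong (λ p → suc (p ℕ.+ p)) (sym (ℕP.m+[n∸m]≡n e<p))) (regroup e q)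

ℚ-ring : AlmostCommutativeRing _ _
ℚ-ring = fromCommutativeRing ℚP.+-*-commutativeRing isZero
  where
  isZero : ∀ x → Maybe (0ℚ ≡ x)
  isZero x with 0ℚ ℚ.≟ x
  ... | yes p = just p
  ... | no _  = nothing

fromℕ : ℕ → ℚ
fromℕ zero    = 0ℚ
fromℕ (suc n) = 1ℚ + fromℕ n

fromℕ-+ : ∀ m n → fromℕ (m ℕ.+ n) ≡ fromℕ m + fromℕ n
fromℕ-+ zero    n = sym (ℚP.+-identityˡ (fromℕ n))
fromℕ-+ (suc m) n = trans (cong (1ℚ +_) (fromℕ-+ m n)) (sym (ℚP.+-assoc 1ℚ (fromℕ m) (fromℕ n)))

fromℕ-toℚᵘ : ∀ n → ℚ.toℚᵘ (fromℕ n) ℚᵘ.≃ mkℚᵘ (ℤ.+ n) 0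
fromℕ-toℚᵘ zero    = *≡* refl
fromℕ-toℚᵘ (suc n) = ℚᵘP.≃-trans (ℚP.toℚᵘ-homo-+ 1ℚ (fromℕ n))
  (ℚᵘP.≃-trans (ℚᵘP.+-congʳ (ℚ.toℚᵘ 1ℚ) (fromℕ-toℚᵘ n)) (*≡* (denominators (ℤ.+ n))))
  where
  denominators : ∀ x → (ℤ.+ 1 ℤ.* ℤ.+ 1 ℤ.+ x ℤ.* ℤ.+ 1) ℤ.* ℤ.+ 1 ≡ (ℤ.+ 1 ℤ.+ x) ℤ.* ℤ.+ 1
  denominators = ℤ-Solver.solve-∀

half≡½*fromℕ : ∀ n → half n ≡ ½ * fromℕ n
half≡½*fromℕ n = ℚP.toℚᵘ-injective (ℚᵘP.≃-trans (ℚP.toℚᵘ-fromℚᵘ (mkℚᵘ (ℤ.+ n) 1))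
  (ℚᵘP.≃-sym (ℚᵘP.≃-trans (ℚP.toℚᵘ-homo-* ½ (fromℕ n))
    (ℚᵘP.≃-trans (ℚᵘP.*-congˡ {ℚ.toℚᵘ ½} (fromℕ-toℚᵘ n)) (*≡* (denominators (ℤ.+ n)))))))
  where
  denominators : ∀ x → (ℤ.+ 1 ℤ.* x) ℤ.* ℤ.+ 2 ≡ x ℤ.* ℤ.+ 2
  denominators = ℤ-Solver.solve-∀

-x*-x≡x*x : ∀ x → (- x) * (- x) ≡ x * x
-x*-x≡x*x = solve-∀ ℚ-ring

0≤x⇒0≤x*x : ∀ {x} → 0ℚ ℚ.≤ x → 0ℚ ℚ.≤ x * x
0≤x⇒0≤x*x {x} 0≤x = subst (ℚ._≤ x * x) (ℚP.*-zeroʳ x) (ℚP.*-monoˡ-≤-nonNeg x {{ℚ.nonNegative 0≤x}} 0≤x)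

square-nonneg : ∀ x → 0ℚ ℚ.≤ x * x
square-nonneg x with ℚP.≤-total 0ℚ x
... | inj₁ 0≤x = 0≤x⇒0≤x*x 0≤x
... | inj₂ x≤0 = subst (0ℚ ℚ.≤_) (-x*-x≡x*x x) (0≤x⇒0≤x*x (ℚP.neg-antimono-≤ x≤0))

½*-nonneg : ∀ {q} → 0ℚ ℚ.≤ q → 0ℚ ℚ.≤ ½ * q
½*-nonneg 0≤q = ℚP.*-monoˡ-≤-nonNeg ½ 0≤q

sign-+ : ∀ m n → sign (m ℕ.+ n) ≡ sign m * sign n
sign-+ zero    n = sym (ℚP.*-identityˡ (sign n))
sign-+ (suc m) n = trans (cong -_ (sign-+ m n)) (ℚP.neg-distribˡ-* (sign m) (sign n))

sign-sq : ∀ n → sign n * sign n ≡ 1ℚ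
sign-sq zero    = refl
sign-sq (suc n) = trans (-x*-x≡x*x (sign n)) (sign-sq n)

sign-∸ : ∀ {m n} → n ≤ m → sign m * sign n ≡ sign (m ∸ n)
sign-∸ {m} {n} n≤m = begin
  sign m * sign n                      ≡⟨ cong (λ k → sign k * sign n) (sym (ℕP.m∸n+n≡m n≤m)) ⟩
  sign (m ∸ n ℕ.+ n) * sign n          ≡⟨ cong (_* sign n) (sign-+ (m ∸ n) n) ⟩
  sign (m ∸ n) * sign n * sign n       ≡⟨ ℚP.*-assoc (sign (m ∸ n)) (sign n) (sign n) ⟩
  sign (m ∸ n) * (sign n * sign n)     ≡⟨ cong (sign (m ∸ n) *_) (sign-sq n) ⟩
  sign (m ∸ n) * 1ℚ                    ≡⟨ ℚP.*-identityʳ (sign (m ∸ n)) ⟩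
  sign (m ∸ n)                         ∎
  where open ≡-Reasoning

𝟙 : Bool → ℚ
𝟙 b = if b then 1ℚ else 0ℚ

𝟙-∨ : ∀ b c → (b ≡ true → c ≡ true → ⊥) → 𝟙 (b ∨ c) ≡ 𝟙 b + 𝟙 c
𝟙-∨ true  true  excl = ⊥-elim (excl refl refl)
𝟙-∨ true  false _    = refl
𝟙-∨ false true  _    = refl
𝟙-∨ false false _    = refl

δ : ℕ → ℕ → ℚ
δ m n = 𝟙 (m ≡ᵇ n)

δ-sym : ∀ m n → δ m n ≡ δ n m
δ-sym zero    zero    = refl
δ-sym zero    (suc n) = refl
δ-sym (suc m) zero    = refl
δ-sym (suc m) (suc n) = δ-sym m n

δ-cong : ∀ {m n m′ n′} → (m ≡ n → m′ ≡ n′) → (m′ ≡ n′ → m ≡ n) → δ m n ≡ δ m′ n′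
δ-cong {m} {n} {m′} {n′} to from with m ≡ᵇ n in e | m′ ≡ᵇ n′ in e′
... | true  | true  = refl
... | false | false = refl
... | true  | false = ⊥-elim (subst Bool.T e′ (ℕP.≡⇒≡ᵇ m′ n′ (to (ℕP.≡ᵇ⇒≡ m n (subst Bool.T (sym e) _)))))
... | false | true  = ⊥-elim (subst Bool.T e (ℕP.≡⇒≡ᵇ m n (from (ℕP.≡ᵇ⇒≡ m′ n′ (subst Bool.T (sym e′) _)))))

δ-refl : ∀ n → δ n n ≡ 1ℚ
δ-refl zero    = refl
δ-refl (suc n) = δ-refl n

δ-≢ : ∀ {m n} → m ≢ n → δ m n ≡ 0ℚ
δ-≢ {m} {n} m≢n = δ-cong {m′ = 0} {n′ = 1} (⊥-elim ∘ m≢n) (λ ())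

I≡δ : ∀ {n} (i j : Fin n) → I i j ≡ δ (toℕ i) (toℕ j)
I≡δ i j with i ≟ j
... | yes refl = sym (δ-refl (toℕ i))
... | no i≢j   = sym (δ-≢ (i≢j ∘ toℕ-injective))

∑ : ℕ → (ℕ → ℚ) → ℚ
∑ zero    f = 0ℚ
∑ (suc n) f = f 0 + ∑ n (f ∘ suc)

infix 6.5 ∑
syntax ∑ n (λ i → e) = ∑[ i < n ] e

∑-cong : ∀ n {f g : ℕ → ℚ} → (∀ i → i < n → f i ≡ g i) → ∑ n f ≡ ∑ n g
∑-cong zero    f≗g = refl
∑-cong (suc n) f≗g = cong₂ _+_ (f≗g 0 (s≤s z≤n)) (∑-cong n (λ i i<n → f≗g (suc i) (s≤s i<n)))

∑-zero : ∀ n → ∑[ i < n ] 0ℚ ≡ 0ℚ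
∑-zero zero    = refl
∑-zero (suc n) = cong (0ℚ +_) (∑-zero n)

∑-+ : ∀ n (f g : ℕ → ℚ) → ∑[ i < n ] (f i + g i) ≡ ∑ n f + ∑ n g
∑-+ zero    f g = refl
∑-+ (suc n) f g = trans (cong ((f 0 + g 0) +_) (∑-+ n (f ∘ suc) (g ∘ suc)))
                        (interchange (f 0) (g 0) (∑ n (f ∘ suc)) (∑ n (g ∘ suc)))
  where
  interchange : ∀ a b c d → (a + b) + (c + d) ≡ (a + c) + (b + d)
  interchange = solve-∀ ℚ-ring

∑-*ˡ : ∀ n c (f : ℕ → ℚ) → ∑[ i < n ] (c * f i) ≡ c * ∑ n f
∑-*ˡ zero    c f = sym (ℚP.*-zeroʳ c)
∑-*ˡ (suc n) c f = trans (cong (c * f 0 +_) (∑-*ˡ n c (f ∘ suc)))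
                         (sym (ℚP.*-distribˡ-+ c (f 0) (∑ n (f ∘ suc))))

∑-*ʳ : ∀ n c (f : ℕ → ℚ) → ∑[ i < n ] (f i * c) ≡ ∑ n f * c
∑-*ʳ n c f = trans (∑-cong n (λ i _ → ℚP.*-comm (f i) c))
                   (trans (∑-*ˡ n c f) (ℚP.*-comm c (∑ n f)))

∑-const : ∀ n c → ∑[ i < n ] c ≡ fromℕ n * c
∑-const zero    c = sym (ℚP.*-zeroˡ c)
∑-const (suc n) c = trans (cong (c +_) (∑-const n c)) (distrib c (fromℕ n))
  where
  distrib : ∀ c n → c + n * c ≡ (1ℚ + n) * c
  distrib = solve-∀ ℚ-ring

∑-snoc : ∀ n (f : ℕ → ℚ) → ∑ (suc n) f ≡ ∑ n f + f n
∑-snoc zero    f = ℚP.+-comm (f 0) 0ℚ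
∑-snoc (suc n) f = trans (cong (f 0 +_) (∑-snoc n (f ∘ suc))) (sym (ℚP.+-assoc (f 0) _ _))

∑-swap : ∀ m n (f : ℕ → ℕ → ℚ) → ∑[ i < m ] ∑[ j < n ] f i j ≡ ∑[ j < n ] ∑[ i < m ] f i j
∑-swap zero    n f = sym (∑-zero n)
∑-swap (suc m) n f = trans (cong (∑ n (f 0) +_) (∑-swap m n (f ∘ suc)))
                           (sym (∑-+ n (f 0) (λ j → ∑[ i < m ] f (suc i) j)))

∑-δ : ∀ n {c} (f : ℕ → ℚ) → c < n → ∑[ i < n ] (δ c i * f i) ≡ f c
∑-δ (suc n) {zero}  f _ = begin
  1ℚ * f 0 + ∑[ i < n ] (0ℚ * f (suc i))
    ≡⟨ cong₂ _+_ (ℚP.*-identityˡ (f 0)) (∑-cong n (λ i _ → ℚP.*-zeroˡ (f (suc i)))) ⟩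
  f 0 + ∑[ i < n ] 0ℚ                     ≡⟨ cong (f 0 +_) (∑-zero n) ⟩
  f 0 + 0ℚ                                ≡⟨ ℚP.+-identityʳ (f 0) ⟩
  f 0                                     ∎
  where open ≡-Reasoning
∑-δ (suc n) {suc c} f (s≤s c<n) = trans (cong (_+ ∑[ i < n ] (δ c i * f (suc i))) (ℚP.*-zeroˡ (f 0)))
                                        (trans (ℚP.+-identityˡ _) (∑-δ n (f ∘ suc) c<n))

∑-reverse : ∀ n (f : ℕ → ℚ) → ∑[ j < n ] f (n ∸ j) ≡ ∑[ j < n ] f (suc j)
∑-reverse zero    f = refl
∑-reverse (suc n) f = begin
  f (suc n) + ∑[ j < n ] f (n ∸ j)  ≡⟨ cong (f (suc n) +_) (∑-reverse n f) ⟩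
  f (suc n) + ∑[ j < n ] f (suc j)  ≡⟨ ℚP.+-comm (f (suc n)) _ ⟩
  ∑[ j < n ] f (suc j) + f (suc n)  ≡⟨ sym (∑-snoc n (f ∘ suc)) ⟩
  ∑[ j < suc n ] f (suc j)          ∎
  where open ≡-Reasoning

∑-nonneg : ∀ n (f : ℕ → ℚ) → (∀ i → 0ℚ ℚ.≤ f i) → 0ℚ ℚ.≤ ∑ n f
∑-nonneg zero    f f≥0 = ℚP.≤-refl
∑-nonneg (suc n) f f≥0 = ℚP.+-mono-≤ (f≥0 0) (∑-nonneg n (f ∘ suc) (f≥0 ∘ suc))

Σ≡∑ : ∀ n (f : Fin n → ℚ) (g : ℕ → ℚ) → (∀ i → f i ≡ g (toℕ i)) → Σ f ≡ ∑ n g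
Σ≡∑ zero    f g f≗g = refl
Σ≡∑ (suc n) f g f≗g = cong₂ _+_ (f≗g zero) (Σ≡∑ n (f ∘ suc) (g ∘ suc) (f≗g ∘ suc))

∑-range : ∀ K a (f : ℕ → ℚ) → foldr _+_ 0ℚ (map f (range a K)) ≡ ∑[ d < K ] f (a ℕ.+ d)
∑-range zero    a f = refl
∑-range (suc K) a f = cong₂ _+_ (cong f (sym (ℕP.+-identityʳ a)))
  (trans (∑-range K (suc a) f) (∑-cong K (λ d _ → cong f (sym (ℕP.+-suc a d)))))

Σk≡∑ : ∀ K (f : ℕ → ℚ) → Σk K f ≡ ∑[ d < K ] f (suc d)
Σk≡∑ K = ∑-range K 1

ramp : ℕ → (ℕ → ℚ) → ℚ
ramp N a = ∑[ e < N ] fromℕ (N ∸ suc e) * a e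

ramp-suc : ∀ N (a : ℕ → ℚ) → ramp (suc N) a ≡ ramp N a + ∑ N a
ramp-suc N a = begin
  ∑[ e < suc N ] fromℕ (N ∸ e) * a e                      ≡⟨ ∑-snoc N _ ⟩
  ∑[ e < N ] fromℕ (N ∸ e) * a e + fromℕ (N ∸ N) * a N
    ≡⟨ cong₂ _+_ (∑-cong N step) (cong (λ k → fromℕ k * a N) (ℕP.n∸n≡0 N)) ⟩
  ∑[ e < N ] (fromℕ (N ∸ suc e) * a e + a e) + 0ℚ * a N   ≡⟨ cong₂ _+_ (∑-+ N _ a) (ℚP.*-zeroˡ (a N)) ⟩
  ramp N a + ∑ N a + 0ℚ                                   ≡⟨ ℚP.+-identityʳ _ ⟩
  ramp N a + ∑ N a                                        ∎
  where
  open ≡-Reasoning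
  step : ∀ e → e < N → fromℕ (N ∸ e) * a e ≡ fromℕ (N ∸ suc e) * a e + a e
  step e e<N = trans (cong (λ k → fromℕ k * a e) (ℕP.+-∸-assoc 1 e<N)) (distrib (fromℕ (N ∸ suc e)) (a e))
    where
    distrib : ∀ x y → (1ℚ + x) * y ≡ x * y + y
    distrib = solve-∀ ℚ-ring

ramp-pair : ∀ p (a : ℕ → ℚ) → ramp p a + ramp (suc p) a ≡ ∑[ e < p ] fromℕ (suc (p ℕ.+ p) ∸ 2 ℕ.* suc e) * a e
ramp-pair p a = begin
  ramp p a + ramp (suc p) a                                  ≡⟨ cong (ramp p a +_) (ramp-suc p a) ⟩
  ramp p a + (ramp p a + ∑ p a)                              ≡⟨ sym (cong (ramp p a +_) (∑-+ p _ a)) ⟩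
  ramp p a + ∑[ e < p ] (fromℕ (p ∸ suc e) * a e + a e)      ≡⟨ sym (∑-+ p _ _) ⟩
  ∑[ e < p ] (fromℕ (p ∸ suc e) * a e + (fromℕ (p ∸ suc e) * a e + a e))  ≡⟨ ∑-cong p step ⟩
  ∑[ e < p ] fromℕ (suc (p ℕ.+ p) ∸ 2 ℕ.* suc e) * a e      ∎
  where
  open ≡-Reasoning
  step : ∀ e → e < p → fromℕ (p ∸ suc e) * a e + (fromℕ (p ∸ suc e) * a e + a e)
                       ≡ fromℕ (suc (p ℕ.+ p) ∸ 2 ℕ.* suc e) * a e
  step e e<p = begin
    x * a e + (x * a e + a e)   ≡⟨ distrib x (a e) ⟩
    (1ℚ + (x + x)) * a e        ≡⟨ cong (λ z → (1ℚ + z) * a e) (sym (fromℕ-+ q q)) ⟩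
    fromℕ (suc (q ℕ.+ q)) * a e ≡⟨ cong (λ k → fromℕ k * a e) (sym (odd∸even e<p)) ⟩
    fromℕ (suc (p ℕ.+ p) ∸ 2 ℕ.* suc e) * a e ∎
    where
    q = p ∸ suc e
    x = fromℕ q
    distrib : ∀ x y → x * y + (x * y + y) ≡ (1ℚ + (x + x)) * y
    distrib = solve-∀ ℚ-ring

Periodic : ℕ → (ℕ → ℚ) → Set
Periodic M G = ∀ j → G (j ℕ.+ M) ≡ G j

∑-rotate₁ : ∀ M (G : ℕ → ℚ) → Periodic M G → ∑ M (G ∘ suc) ≡ ∑ M G
∑-rotate₁ M G G-per = ∙-cancelˡ ℚP.+-0-group (G 0) _ _ (begin
  ∑ (suc M) G   ≡⟨ ∑-snoc M G ⟩
  ∑ M G + G M   ≡⟨ cong (∑ M G +_) (G-per 0) ⟩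
  ∑ M G + G 0   ≡⟨ ℚP.+-comm (∑ M G) (G 0) ⟩
  G 0 + ∑ M G   ∎)
  where open ≡-Reasoning

∑-rotate : ∀ M s (G : ℕ → ℚ) → Periodic M G → ∑[ t < M ] G (s ℕ.+ t) ≡ ∑ M G
∑-rotate M zero    G G-per = refl
∑-rotate M (suc s) G G-per = trans (∑-rotate M s (G ∘ suc) (G-per ∘ suc)) (∑-rotate₁ M G G-per)

alt : ℕ → ℚ
alt N = ∑ N sign

alt-cases : ∀ N → (alt N ≡ 0ℚ × sign N ≡ 1ℚ) ⊎ (alt N ≡ 1ℚ × sign N ≡ - 1ℚ)
alt-cases zero = inj₁ (refl , refl)
alt-cases (suc N) with alt-cases N
... | inj₁ (a≡0 , s≡1)  = inj₂ (trans (∑-snoc N sign) (cong₂ _+_ a≡0 s≡1) , cong -_ s≡1)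
... | inj₂ (a≡1 , s≡-1) = inj₁ (trans (∑-snoc N sign) (cong₂ _+_ a≡1 s≡-1) , cong -_ s≡-1)

alt-sq+alt-sq : ∀ N → alt N * alt N + alt (suc N) * alt (suc N) ≡ 1ℚ
alt-sq+alt-sq N with alt-cases N
... | inj₁ (a≡0 , s≡1)  = cong₂ (λ a a′ → a * a + a′ * a′) a≡0 (trans (∑-snoc N sign) (cong₂ _+_ a≡0 s≡1))
... | inj₂ (a≡1 , s≡-1) = cong₂ (λ a a′ → a * a + a′ * a′) a≡1 (trans (∑-snoc N sign) (cong₂ _+_ a≡1 s≡-1))

[m%n+k]%n≡[m+k]%n : ∀ m k n .{{_ : NonZero n}} → (m % n ℕ.+ k) % n ≡ (m ℕ.+ k) % n
[m%n+k]%n≡[m+k]%n m k n = begin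
  (m % n ℕ.+ k) % n            ≡⟨ %-distribˡ-+ (m % n) k n ⟩
  (m % n % n ℕ.+ k % n) % n    ≡⟨ cong (λ r → (r ℕ.+ k % n) % n) (m%n%n≡m%n m n) ⟩
  (m % n ℕ.+ k % n) % n        ≡⟨ sym (%-distribˡ-+ m k n) ⟩
  (m ℕ.+ k) % n                ∎
  where open ≡-Reasoning

%-cancel : ∀ {M x y j k} .{{_ : NonZero M}} → x < M → j ℕ.+ k ≡ M → (x ℕ.+ j) % M ≡ y → (y ℕ.+ k) % M ≡ x
%-cancel {M} {x} {y} {j} {k} x<M j+k≡M x+j≡y = begin
  (y ℕ.+ k) % M                ≡⟨ cong (λ r → (r ℕ.+ k) % M) (sym x+j≡y) ⟩
  ((x ℕ.+ j) % M ℕ.+ k) % M    ≡⟨ [m%n+k]%n≡[m+k]%n (x ℕ.+ j) k M ⟩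
  (x ℕ.+ j ℕ.+ k) % M          ≡⟨ cong (_% M) (trans (ℕP.+-assoc x j k) (cong (x ℕ.+_) j+k≡M)) ⟩
  (x ℕ.+ M) % M                ≡⟨ [m+n]%n≡m%n x M ⟩
  x % M                        ≡⟨ m<n⇒m%n≡m x<M ⟩
  x                            ∎
  where open ≡-Reasoning

cyclicShift : (M : ℕ) .{{_ : NonZero M}} → ℕ → ℕ → ℕ → ℚ
cyclicShift M k a b = δ ((a ℕ.+ k) % M) b

cyclicShift-transpose : ∀ {M k a b} .{{_ : NonZero M}} → k ≤ M → a < M → b < M → cyclicShift M k a b ≡ cyclicShift M (M ∸ k) b a
cyclicShift-transpose {M} {k} k≤M a<M b<M =
  δ-cong (%-cancel a<M (ℕP.m+[n∸m]≡n k≤M))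
         (%-cancel b<M (trans (ℕP.+-comm (M ∸ k) k) (ℕP.m+[n∸m]≡n k≤M)))

offset≡cyclicShift : ∀ {M a b t} .{{_ : NonZero M}} → a < M → b < M → t < M →
              δ ((b ℕ.+ M ∸ a) % M) t ≡ cyclicShift M t a b
offset≡cyclicShift {M} {a} {b} {t} a<M b<M t<M = δ-cong to from
  where
  a≤M = ℕP.<⇒≤ a<M
  a+[M∸a]≡M = ℕP.m+[n∸m]≡n a≤M
  b+M∸a≡b+[M∸a] = cong (_% M) (ℕP.+-∸-assoc b a≤M)
  to : (b ℕ.+ M ∸ a) % M ≡ t → (a ℕ.+ t) % M ≡ b
  to e = trans (cong (_% M) (ℕP.+-comm a t))
               (%-cancel b<M (trans (ℕP.+-comm (M ∸ a) a) a+[M∸a]≡M) (trans (sym b+M∸a≡b+[M∸a]) e))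
  from : (a ℕ.+ t) % M ≡ b → (b ℕ.+ M ∸ a) % M ≡ t
  from e = trans b+M∸a≡b+[M∸a] (%-cancel t<M a+[M∸a]≡M (trans (cong (_% M) (ℕP.+-comm t a)) e))

cvec≡δ+δ : ∀ {M k} (t : Fin M) → k ℕ.+ k < M → cvec (suc M) k t ≡ δ (toℕ t) k + δ (toℕ t) (M ∸ k)
cvec≡δ+δ {M} {k} t k+k<M = trans (cong (λ r → 𝟙 ((toℕ t ≡ᵇ k) ∨ (suc (toℕ t) ≡ᵇ r))) (ℕP.+-∸-assoc 1 k≤M))
                                  (𝟙-∨ _ _ exclusive)
  where
  k≤M : k ≤ M
  k≤M = ℕP.≤-trans (ℕP.m≤m+n k k) (ℕP.<⇒≤ k+k<M)
  exclusive : (toℕ t ≡ᵇ k) ≡ true → (toℕ t ≡ᵇ M ∸ k) ≡ true → ⊥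
  exclusive e e′ = ℕP.<-irrefl (ℕP.m+[n∸m]≡n k≤M) (subst (λ r → k ℕ.+ r < M) k≡M∸k k+k<M)
    where
    k≡M∸k : k ≡ M ∸ k
    k≡M∸k = trans (sym (ℕP.≡ᵇ⇒≡ (toℕ t) k (subst Bool.T (sym e) _)))
                  (ℕP.≡ᵇ⇒≡ (toℕ t) (M ∸ k) (subst Bool.T (sym e′) _))

Circ-cvec : ∀ {m k} (i j : Fin (suc m)) → 1 ≤ k → k ℕ.+ k < suc m →
            Circ (cvec (suc (suc m)) k) i j
            ≡ cyclicShift (suc m) k (toℕ i) (toℕ j) + cyclicShift (suc m) (suc m ∸ k) (toℕ i) (toℕ j)
Circ-cvec {m} {k} i j 1≤k k+k<M = trans (cvec≡δ+δ ((toℕ j ℕ.+ suc m ∸ toℕ i) mod suc m) k+k<M)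
  (cong₂ _+_ (trans (cong (λ u → δ u k) toℕ-offset) (offset≡cyclicShift (toℕ<n i) (toℕ<n j) k<M))
             (trans (cong (λ u → δ u (suc m ∸ k)) toℕ-offset) (offset≡cyclicShift (toℕ<n i) (toℕ<n j) M∸k<M)))
  where
  toℕ-offset = toℕ-fromℕ< (m%n<n (toℕ j ℕ.+ suc m ∸ toℕ i) (suc m))
  k<M : k < suc m
  k<M = ℕP.<-≤-trans (ℕP.m<m+n k 1≤k) (ℕP.<⇒≤ k+k<M)
  M∸k<M : suc m ∸ k < suc m
  M∸k<M = ℕP.∸-monoʳ-< 1≤k (ℕP.<⇒≤ k<M)

module Autocorrelation (M : ℕ) .{{_ : NonZero M}} (y : Fin M → ℚ) where

  Y : ℕ → ℚ
  Y t = y (t mod M)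

  Y-mod : ∀ {t u} → t % M ≡ u % M → Y t ≡ Y u
  Y-mod e = cong y (toℕ-injective (trans (toℕ-fromℕ< _) (trans e (sym (toℕ-fromℕ< _)))))

  Y-toℕ : ∀ i → Y (toℕ i) ≡ y i
  Y-toℕ i = cong y (toℕ-injective (trans (toℕ-fromℕ< _) (m<n⇒m%n≡m (toℕ<n i))))

  Y-periodic : Periodic M Y
  Y-periodic j = Y-mod ([m+n]%n≡m%n j M)

  S : ℚ
  S = ∑ M Y

  T : ℕ → ℚ
  T d = ∑[ a < M ] Y a * Y (a ℕ.+ d)

  T± : ℕ → ℚ
  T± d = sign d * T d

  ∑-Y-shift : ∀ j → ∑[ i < M ] Y (i ℕ.+ j) ≡ S
  ∑-Y-shift j = trans (∑-cong M (λ i _ → cong Y (ℕP.+-comm i j))) (∑-rotate M j Y Y-periodic)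

  ∑-lag : ∀ {j N} → j ≤ N → ∑[ i < M ] Y (i ℕ.+ j) * Y (i ℕ.+ N) ≡ T (N ∸ j)
  ∑-lag {j} {N} j≤N = trans (∑-cong M (λ i _ → cong₂ _*_ (cong Y (ℕP.+-comm i j)) (cong Y (reassoc i))))
                            (∑-rotate M j G G-periodic)
    where
    G : ℕ → ℚ
    G u = Y u * Y (u ℕ.+ (N ∸ j))
    G-periodic : Periodic M G
    G-periodic u = cong₂ _*_ (Y-periodic u)
      (trans (cong Y (+-right-comm u M (N ∸ j))) (Y-periodic (u ℕ.+ (N ∸ j))))
    reassoc : ∀ i → i ℕ.+ N ≡ j ℕ.+ i ℕ.+ (N ∸ j)
    reassoc i = begin
      i ℕ.+ N                ≡⟨ cong (i ℕ.+_) (sym (ℕP.m+[n∸m]≡n j≤N)) ⟩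
      i ℕ.+ (j ℕ.+ (N ∸ j))  ≡⟨ sym (ℕP.+-assoc i j (N ∸ j)) ⟩
      i ℕ.+ j ℕ.+ (N ∸ j)    ≡⟨ cong (ℕ._+ (N ∸ j)) (ℕP.+-comm i j) ⟩
      j ℕ.+ i ℕ.+ (N ∸ j)    ∎
      where open ≡-Reasoning

  T-reflect : ∀ {k} → k ≤ M → T (M ∸ k) ≡ T k
  T-reflect {k} k≤M = trans (sym (∑-lag k≤M))
    (∑-cong M (λ i _ → trans (cong (Y (i ℕ.+ k) *_) (Y-periodic i)) (ℚP.*-comm (Y (i ℕ.+ k)) (Y i))))

  W : ℕ → ℕ → ℚ
  W N i = ∑[ j < N ] sign j * Y (i ℕ.+ j)

  ∑-W : ∀ N → ∑[ i < M ] W N i ≡ alt N * S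
  ∑-W N = begin
    ∑[ i < M ] ∑[ j < N ] sign j * Y (i ℕ.+ j)   ≡⟨ ∑-swap M N _ ⟩
    ∑[ j < N ] ∑[ i < M ] sign j * Y (i ℕ.+ j)
      ≡⟨ ∑-cong N (λ j _ → trans (∑-*ˡ M (sign j) _) (cong (sign j *_) (∑-Y-shift j))) ⟩
    ∑[ j < N ] sign j * S                        ≡⟨ ∑-*ʳ N S sign ⟩
    alt N * S                                    ∎
    where open ≡-Reasoning

  W-cross : ∀ N → sign N * (∑[ i < M ] Y (i ℕ.+ N) * W N i) ≡ ∑[ e < N ] T± (suc e)
  W-cross N = begin
    sign N * (∑[ i < M ] Y (i ℕ.+ N) * W N i)
      ≡⟨ cong (sign N *_) (∑-cong M (λ i _ → trans (sym (∑-*ˡ N (Y (i ℕ.+ N)) (λ j → sign j * Y (i ℕ.+ j))))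
           (∑-cong N (λ j _ → rearrange (Y (i ℕ.+ N)) (sign j) (Y (i ℕ.+ j)))))) ⟩
    sign N * (∑[ i < M ] ∑[ j < N ] sign j * (Y (i ℕ.+ j) * Y (i ℕ.+ N)))
      ≡⟨ cong (sign N *_) (∑-swap M N _) ⟩
    sign N * (∑[ j < N ] ∑[ i < M ] sign j * (Y (i ℕ.+ j) * Y (i ℕ.+ N)))
      ≡⟨ cong (sign N *_) (∑-cong N (λ j j<N → trans (∑-*ˡ M (sign j) _) (cong (sign j *_) (∑-lag (ℕP.<⇒≤ j<N))))) ⟩
    sign N * (∑[ j < N ] sign j * T (N ∸ j))
      ≡⟨ sym (∑-*ˡ N (sign N) _) ⟩
    ∑[ j < N ] sign N * (sign j * T (N ∸ j))
      ≡⟨ ∑-cong N (λ j j<N → trans (sym (ℚP.*-assoc (sign N) (sign j) _))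
                                   (cong (_* T (N ∸ j)) (sign-∸ (ℕP.<⇒≤ j<N)))) ⟩
    ∑[ j < N ] T± (N ∸ j)
      ≡⟨ ∑-reverse N T± ⟩
    ∑[ e < N ] T± (suc e) ∎
    where
    open ≡-Reasoning
    rearrange : ∀ a s b → a * (s * b) ≡ s * (b * a)
    rearrange = solve-∀ ℚ-ring

  energy : ℕ → ℚ
  energy N = fromℕ N * T 0 + (ramp N (T± ∘ suc) + ramp N (T± ∘ suc))

  W-energy : ∀ N → ∑[ i < M ] W N i * W N i ≡ energy N
  W-energy zero = trans (∑-zero M) (sym (cong (_+ (0ℚ + 0ℚ)) (ℚP.*-zeroˡ (T 0))))
  W-energy (suc N) = begin
    ∑[ i < M ] W (suc N) i * W (suc N) i
      ≡⟨ ∑-cong M (λ i _ → trans (cong (λ w → w * w) (∑-snoc N _)) (square (W N i) (Y (i ℕ.+ N)))) ⟩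
    ∑[ i < M ] (W N i * W N i + (sign N * (Y (i ℕ.+ N) * W N i) + sign N * (Y (i ℕ.+ N) * W N i)) + Y (i ℕ.+ N) * Y (i ℕ.+ N))
      ≡⟨ trans (∑-+ M _ (λ i → Y (i ℕ.+ N) * Y (i ℕ.+ N)))
           (cong (_+ ∑[ i < M ] Y (i ℕ.+ N) * Y (i ℕ.+ N))
             (trans (∑-+ M (λ i → W N i * W N i) _) (cong (∑[ i < M ] W N i * W N i +_) (∑-+ M cross-term cross-term)))) ⟩
    ∑[ i < M ] W N i * W N i + (∑[ i < M ] sign N * (Y (i ℕ.+ N) * W N i) + ∑[ i < M ] sign N * (Y (i ℕ.+ N) * W N i))
      + ∑[ i < M ] Y (i ℕ.+ N) * Y (i ℕ.+ N)
      ≡⟨ cong₂ _+_ (cong₂ _+_ (W-energy N) (cong₂ _+_ cross cross)) diagonal ⟩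
    fromℕ N * T 0 + (R + R) + (X + X) + T 0
      ≡⟨ regroup (fromℕ N) (T 0) R X ⟩
    fromℕ (suc N) * T 0 + ((R + X) + (R + X))
      ≡⟨ cong (λ r → fromℕ (suc N) * T 0 + (r + r)) (sym (ramp-suc N (T± ∘ suc))) ⟩
    fromℕ (suc N) * T 0 + (ramp (suc N) (T± ∘ suc) + ramp (suc N) (T± ∘ suc)) ∎
    where
    open ≡-Reasoning
    R = ramp N (T± ∘ suc)
    X = ∑[ e < N ] T± (suc e)
    cross-term : ℕ → ℚ
    cross-term i = sign N * (Y (i ℕ.+ N) * W N i)
    expand : ∀ w s v → (w + s * v) * (w + s * v) ≡ w * w + (s * (v * w) + s * (v * w)) + (s * s) * (v * v)
    expand = solve-∀ ℚ-ring
    square : ∀ w v → (w + sign N * v) * (w + sign N * v) ≡ w * w + (sign N * (v * w) + sign N * (v * w)) + v * v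
    square w v = trans (expand w (sign N) v)
      (cong (w * w + (sign N * (v * w) + sign N * (v * w)) +_) (trans (cong (_* (v * v)) (sign-sq N)) (ℚP.*-identityˡ (v * v))))
    cross : ∑[ i < M ] sign N * (Y (i ℕ.+ N) * W N i) ≡ X
    cross = trans (∑-*ˡ M (sign N) _) (W-cross N)
    diagonal : ∑[ i < M ] Y (i ℕ.+ N) * Y (i ℕ.+ N) ≡ T 0
    diagonal = trans (∑-lag ℕP.≤-refl) (cong T (ℕP.n∸n≡0 N))
    regroup : ∀ n t r x → n * t + (r + r) + (x + x) + t ≡ (1ℚ + n) * t + ((r + x) + (r + x))
    regroup = solve-∀ ℚ-ring

  W-offset-energy : ∀ N c → ∑[ i < M ] (W N i + - c) * (W N i + - c)
                            ≡ energy N + - (c + c) * (alt N * S) + fromℕ M * (c * c)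
  W-offset-energy N c = begin
    ∑[ i < M ] (W N i + - c) * (W N i + - c)
      ≡⟨ ∑-cong M (λ i _ → expand (W N i) c) ⟩
    ∑[ i < M ] (W N i * W N i + - (c + c) * W N i + c * c)
      ≡⟨ trans (∑-+ M _ (λ _ → c * c)) (cong (_+ ∑[ i < M ] c * c) (∑-+ M (λ i → W N i * W N i) _)) ⟩
    ∑[ i < M ] W N i * W N i + ∑[ i < M ] - (c + c) * W N i + ∑[ i < M ] c * c
      ≡⟨ cong₂ _+_ (cong₂ _+_ (W-energy N) (trans (∑-*ˡ M (- (c + c)) (W N)) (cong (- (c + c) *_) (∑-W N))))
                   (∑-const M (c * c)) ⟩
    energy N + - (c + c) * (alt N * S) + fromℕ M * (c * c) ∎
    where
    open ≡-Reasoning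
    expand : ∀ w c → (w + - c) * (w + - c) ≡ w * w + - (c + c) * w + c * c
    expand = solve-∀ ℚ-ring

  Q : (ℕ → ℕ → ℚ) → ℚ
  Q B = ∑[ a < M ] ∑[ b < M ] Y a * B a b * Y b

  Q-+ : ∀ B C → Q (λ a b → B a b + C a b) ≡ Q B + Q C
  Q-+ B C = trans (∑-cong M (λ a _ → trans (∑-cong M (λ b _ → distrib (Y a) (B a b) (C a b) (Y b))) (∑-+ M _ _)))
                  (∑-+ M _ _)
    where
    distrib : ∀ u x z v → u * (x + z) * v ≡ u * x * v + u * z * v
    distrib = solve-∀ ℚ-ring

  Q-*ˡ : ∀ c B → Q (λ a b → c * B a b) ≡ c * Q B
  Q-*ˡ c B = trans (∑-cong M (λ a _ → trans (∑-cong M (λ b _ → pull (Y a) c (B a b) (Y b))) (∑-*ˡ M c _)))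
                   (∑-*ˡ M c _)
    where
    pull : ∀ u c x v → u * (c * x) * v ≡ c * (u * x * v)
    pull = solve-∀ ℚ-ring

  Q-∑ : ∀ K (B : ℕ → ℕ → ℕ → ℚ) → Q (λ a b → ∑[ d < K ] B d a b) ≡ ∑[ d < K ] Q (B d)
  Q-∑ K B = trans (∑-cong M (λ a _ → trans (∑-cong M (λ b _ → distrib a b)) (∑-swap M K _))) (∑-swap M K _)
    where
    distrib : ∀ a b → Y a * (∑[ d < K ] B d a b) * Y b ≡ ∑[ d < K ] Y a * B d a b * Y b
    distrib a b = trans (cong (_* Y b) (sym (∑-*ˡ K (Y a) (λ d → B d a b)))) (sym (∑-*ʳ K (Y b) _))

  Q-δ∘ : ∀ (σ : ℕ → ℕ) → (∀ a → a < M → σ a < M) → Q (λ a b → δ (σ a) b) ≡ ∑[ a < M ] Y a * Y (σ a)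
  Q-δ∘ σ σ<M = ∑-cong M (λ a a<M → trans (∑-cong M (λ b _ → swap (Y a) (δ (σ a) b) (Y b)))
                                                  (∑-δ M (λ b → Y a * Y b) (σ<M a a<M)))
    where
    swap : ∀ u d v → u * d * v ≡ d * (u * v)
    swap = solve-∀ ℚ-ring

  Q-δ : Q δ ≡ T 0
  Q-δ = trans (Q-δ∘ (λ a → a) (λ _ a<M → a<M))
              (∑-cong M (λ a _ → cong (λ b → Y a * Y b) (sym (ℕP.+-identityʳ a))))

  Q-cyclicShift : ∀ k → Q (cyclicShift M k) ≡ T k
  Q-cyclicShift k = trans (Q-δ∘ (λ a → (a ℕ.+ k) % M) (λ a _ → m%n<n (a ℕ.+ k) M))
                   (∑-cong M (λ a _ → cong (Y a *_) (Y-mod (m%n%n≡m%n (a ℕ.+ k) M))))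

Σk-*0 : ∀ K (c : ℕ → ℚ) → Σk K (λ k → c k * 0ℚ) ≡ 0ℚ
Σk-*0 K c = trans (Σk≡∑ K _) (trans (∑-cong K (λ d _ → ℚP.*-zeroʳ (c (suc d)))) (∑-zero K))

module Wheel (p : ℕ) where

  M : ℕ
  M = suc (p ℕ.+ p)

  L : Matrix (suc M)
  L = specialLaplacian (suc M)

  coef : ℕ → ℚ
  coef k = sign k * half (M ∸ 2 ℕ.* k)

  C : ℕ → ℕ → ℕ → ℚ
  C k a b = cyclicShift M k a b + cyclicShift M (M ∸ k) a b

  block : ℕ → ℕ → ℚ
  block a b = half M * δ a b + ∑[ d < p ] coef (suc d) * C (suc d) a b

  K : ℕ
  K = suc M ℕ./ 2 ∸ 1

  K≡p : K ≡ p
  K≡p = cong (_∸ 1) (trans (cong (ℕ._/ 2) (sym ([1+p]*2≡2+p+p p))) (m*n/n≡m (suc p) 2))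

  lag+lag<M : ∀ {d} → d < p → suc d ℕ.+ suc d < M
  lag+lag<M d<p = s≤s (ℕP.+-mono-≤ d<p d<p)

  lag≤M : ∀ {d} → d < p → suc d ≤ M
  lag≤M {d} d<p = ℕP.≤-trans (ℕP.m≤m+n (suc d) (suc d)) (ℕP.<⇒≤ (lag+lag<M d<p))

  L-corner : L zero zero ≡ half M
  L-corner = trans (cong (half M * 1ℚ + - (½ * 0ℚ) +_) (Σk-*0 K coef)) (simplify (half M))
    where
    simplify : ∀ h → h * 1ℚ + - (½ * 0ℚ) + 0ℚ ≡ h
    simplify = solve-∀ ℚ-ring

  L-border : half M * 0ℚ + - (½ * 1ℚ) + Σk K (λ k → coef k * 0ℚ) ≡ - ½
  L-border = trans (cong (half M * 0ℚ + - (½ * 1ℚ) +_) (Σk-*0 K coef)) (simplify (half M))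
    where
    simplify : ∀ h → h * 0ℚ + - (½ * 1ℚ) + 0ℚ ≡ - ½
    simplify = solve-∀ ℚ-ring

  L-top : ∀ j → L zero (suc j) ≡ - ½
  L-top j = L-border

  L-left : ∀ i → L (suc i) zero ≡ - ½
  L-left i = L-border

  L-block : ∀ i j → L (suc i) (suc j) ≡ block (toℕ i) (toℕ j)
  L-block i j = trans (cong₂ (λ u v → half M * u + - (½ * 0ℚ) + v) (I≡δ (suc i) (suc j)) circulants)
                      (simplify (half M * δ (toℕ i) (toℕ j)) _)
    where
    simplify : ∀ u v → u + - (½ * 0ℚ) + v ≡ u + v
    simplify = solve-∀ ℚ-ring
    circulants : Σk K (λ k → coef k * Circ (cvec (suc M) k) i j)
                 ≡ ∑[ d < p ] coef (suc d) * C (suc d) (toℕ i) (toℕ j)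
    circulants = begin
      Σk K (λ k → coef k * Circ (cvec (suc M) k) i j)
        ≡⟨ Σk≡∑ K _ ⟩
      ∑[ d < K ] coef (suc d) * Circ (cvec (suc M) (suc d)) i j
        ≡⟨ cong (λ K → ∑[ d < K ] coef (suc d) * Circ (cvec (suc M) (suc d)) i j) K≡p ⟩
      ∑[ d < p ] coef (suc d) * Circ (cvec (suc M) (suc d)) i j
        ≡⟨ ∑-cong p (λ d d<p → cong (coef (suc d) *_) (Circ-cvec i j (s≤s z≤n) (lag+lag<M d<p))) ⟩
      ∑[ d < p ] coef (suc d) * C (suc d) (toℕ i) (toℕ j) ∎
      where open ≡-Reasoning

  block-sym : ∀ {a b} → a < M → b < M → block a b ≡ block b a
  block-sym {a} {b} a<M b<M =
    cong₂ (λ u v → half M * u + v) (δ-sym a b) (∑-cong p (λ d d<p → cong (coef (suc d) *_) (pair d<p)))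
    where
    pair : ∀ {d} → d < p → C (suc d) a b ≡ C (suc d) b a
    pair {d} d<p = begin
      cyclicShift M k a b + cyclicShift M (M ∸ k) a b
        ≡⟨ cong₂ _+_ (cyclicShift-transpose k≤M a<M b<M) (cyclicShift-transpose (ℕP.m∸n≤m M k) a<M b<M) ⟩
      cyclicShift M (M ∸ k) b a + cyclicShift M (M ∸ (M ∸ k)) b a
        ≡⟨ cong (λ r → cyclicShift M (M ∸ k) b a + cyclicShift M r b a) (ℕP.m∸[m∸n]≡n k≤M) ⟩
      cyclicShift M (M ∸ k) b a + cyclicShift M k b a
        ≡⟨ ℚP.+-comm (cyclicShift M (M ∸ k) b a) (cyclicShift M k b a) ⟩
      cyclicShift M k b a + cyclicShift M (M ∸ k) b a ∎
      where
      open ≡-Reasoning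
      k = suc d
      k≤M = lag≤M d<p

  L-symmetric : Symmetric L
  L-symmetric zero    zero    = refl
  L-symmetric zero    (suc j) = trans (L-top j) (sym (L-left j))
  L-symmetric (suc i) zero    = trans (L-left i) (sym (L-top i))
  L-symmetric (suc i) (suc j) = trans (L-block i j) (trans (block-sym (toℕ<n i) (toℕ<n j)) (sym (L-block j i)))

  module _ (x : Fin (suc M) → ℚ) where
    open Autocorrelation M (x ∘ suc)

    x₀ : ℚ
    x₀ = x zero

    quadForm-L : quadForm L x ≡ half M * (x₀ * x₀) + - (x₀ * S) + Q block
    quadForm-L = begin
      quadForm L x
        ≡⟨ cong₂ _+_ (cong₂ _+_ (cong (λ l → x₀ * l * x₀) L-corner) top-row) lower-rows ⟩
      x₀ * half M * x₀ + ∑[ b < M ] x₀ * - ½ * Y b + ∑[ a < M ] (Y a * - ½ * x₀ + ∑[ b < M ] Y a * block a b * Y b)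
        ≡⟨ cong₂ (λ u v → x₀ * half M * x₀ + u + v) (∑-*ˡ M (x₀ * - ½) Y)
                 (trans (∑-+ M (λ a → Y a * - ½ * x₀) (λ a → ∑[ b < M ] Y a * block a b * Y b))
                        (cong (_+ Q block) (trans (∑-*ʳ M x₀ (λ a → Y a * - ½)) (cong (_* x₀) (∑-*ʳ M (- ½) Y))))) ⟩
      x₀ * half M * x₀ + x₀ * - ½ * S + (S * - ½ * x₀ + Q block)
        ≡⟨ regroup x₀ (half M) S (Q block) ⟩
      half M * (x₀ * x₀) + - (x₀ * S) + Q block ∎
      where
      open ≡-Reasoning
      regroup : ∀ x h s q → x * h * x + x * - ½ * s + (s * - ½ * x + q) ≡ h * (x * x) + - (x * s) + q
      regroup = solve-∀ ℚ-ring
      top-row : Σ (λ j → x₀ * L zero (suc j) * x (suc j)) ≡ ∑[ b < M ] x₀ * - ½ * Y b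
      top-row = Σ≡∑ M _ (λ b → x₀ * - ½ * Y b) (λ j → cong₂ (λ l v → x₀ * l * v) (L-top j) (sym (Y-toℕ j)))
      entry : ∀ i j → x (suc i) * L (suc i) (suc j) * x (suc j) ≡ Y (toℕ i) * block (toℕ i) (toℕ j) * Y (toℕ j)
      entry i j = trans (cong₂ (λ u v → u * L (suc i) (suc j) * v) (sym (Y-toℕ i)) (sym (Y-toℕ j)))
                        (cong (λ l → Y (toℕ i) * l * Y (toℕ j)) (L-block i j))
      lower-rows : Σ (λ i → x (suc i) * L (suc i) zero * x₀ + Σ (λ j → x (suc i) * L (suc i) (suc j) * x (suc j)))
                   ≡ ∑[ a < M ] (Y a * - ½ * x₀ + ∑[ b < M ] Y a * block a b * Y b)
      lower-rows = Σ≡∑ M _ (λ a → Y a * - ½ * x₀ + ∑[ b < M ] Y a * block a b * Y b)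
        (λ i → cong₂ _+_ (cong₂ (λ v l → v * l * x₀) (sym (Y-toℕ i)) (L-left i))
                         (Σ≡∑ M _ (λ b → Y (toℕ i) * block (toℕ i) b * Y b) (entry i)))

    Q-block : Q block ≡ half M * T 0 + ∑[ d < p ] coef (suc d) * (T (suc d) + T (suc d))
    Q-block = begin
      Q block
        ≡⟨ Q-+ (λ a b → half M * δ a b) (λ a b → ∑[ d < p ] coef (suc d) * C (suc d) a b) ⟩
      Q (λ a b → half M * δ a b) + Q (λ a b → ∑[ d < p ] coef (suc d) * C (suc d) a b)
        ≡⟨ cong₂ _+_ (trans (Q-*ˡ (half M) δ) (cong (half M *_) Q-δ))
                     (trans (Q-∑ p (λ d a b → coef (suc d) * C (suc d) a b)) (∑-cong p (λ d d<p → Q-C d<p))) ⟩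
      half M * T 0 + ∑[ d < p ] coef (suc d) * (T (suc d) + T (suc d)) ∎
      where
      open ≡-Reasoning
      Q-C : ∀ {d} → d < p → Q (λ a b → coef (suc d) * C (suc d) a b) ≡ coef (suc d) * (T (suc d) + T (suc d))
      Q-C {d} d<p = trans (Q-*ˡ (coef (suc d)) (C (suc d))) (cong (coef (suc d) *_)
        (trans (Q-+ (cyclicShift M (suc d)) (cyclicShift M (M ∸ suc d)))
               (cong₂ _+_ (Q-cyclicShift (suc d)) (trans (Q-cyclicShift (M ∸ suc d)) (T-reflect (lag≤M d<p))))))

    closedForm : ℚ
    closedForm = ½ * fromℕ M * (x₀ * x₀ + T 0) + - (x₀ * S) + ∑[ e < p ] fromℕ (M ∸ 2 ℕ.* suc e) * T± (suc e)

    quadForm≡closedForm : quadForm L x ≡ closedForm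
    quadForm≡closedForm = begin
      quadForm L x
        ≡⟨ quadForm-L ⟩
      half M * (x₀ * x₀) + - (x₀ * S) + Q block
        ≡⟨ cong (half M * (x₀ * x₀) + - (x₀ * S) +_) Q-block ⟩
      half M * (x₀ * x₀) + - (x₀ * S) + (half M * T 0 + ∑[ d < p ] coef (suc d) * (T (suc d) + T (suc d)))
        ≡⟨ cong₂ (λ h c → h * (x₀ * x₀) + - (x₀ * S) + (h * T 0 + c))
                 (half≡½*fromℕ M) (∑-cong p (λ d _ → coefficient d)) ⟩
      ½ * fromℕ M * (x₀ * x₀) + - (x₀ * S) + (½ * fromℕ M * T 0 + ∑[ e < p ] fromℕ (M ∸ 2 ℕ.* suc e) * T± (suc e))
        ≡⟨ regroup (½ * fromℕ M) x₀ S (T 0) _ ⟩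
      closedForm ∎
      where
      open ≡-Reasoning
      regroup : ∀ h x s t c → h * (x * x) + - (x * s) + (h * t + c) ≡ h * (x * x + t) + - (x * s) + c
      regroup = solve-∀ ℚ-ring
      coefficient : ∀ d → coef (suc d) * (T (suc d) + T (suc d)) ≡ fromℕ (M ∸ 2 ℕ.* suc d) * T± (suc d)
      coefficient d = trans (cong (λ h → sign (suc d) * h * (T (suc d) + T (suc d))) (half≡½*fromℕ (M ∸ 2 ℕ.* suc d)))
                            (halve (sign (suc d)) (fromℕ (M ∸ 2 ℕ.* suc d)) (T (suc d)))
        where
        halve : ∀ s f t → s * (½ * f) * (t + t) ≡ f * (s * t)
        halve = solve-∀ ℚ-ring

    offsetSquares : ℕ → ℚ
    offsetSquares N = ∑[ i < M ] (W N i + - (alt N * x₀)) * (W N i + - (alt N * x₀))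

    sos≡closedForm : ½ * offsetSquares p + ½ * offsetSquares (suc p) ≡ closedForm
    sos≡closedForm = begin
      ½ * offsetSquares p + ½ * offsetSquares (suc p)
        ≡⟨ cong₂ (λ u v → ½ * u + ½ * v) (W-offset-energy p (α * x₀)) (W-offset-energy (suc p) (β * x₀)) ⟩
      ½ * (energy p + - (α * x₀ + α * x₀) * (α * S) + fromℕ M * (α * x₀ * (α * x₀)))
        + ½ * (energy (suc p) + - (β * x₀ + β * x₀) * (β * S) + fromℕ M * (β * x₀ * (β * x₀)))
        ≡⟨ factor (energy p) (energy (suc p)) α β x₀ S (fromℕ M) ⟩
      ½ * (energy p + energy (suc p)) + (α * α + β * β) * (½ * fromℕ M * (x₀ * x₀) + - (x₀ * S))
        ≡⟨ cong (λ w → ½ * (energy p + energy (suc p)) + w * (½ * fromℕ M * (x₀ * x₀) + - (x₀ * S)))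
                (alt-sq+alt-sq p) ⟩
      ½ * (energy p + energy (suc p)) + 1ℚ * (½ * fromℕ M * (x₀ * x₀) + - (x₀ * S))
        ≡⟨ cong (λ m → ½ * (energy p + energy (suc p)) + 1ℚ * (½ * m * (x₀ * x₀) + - (x₀ * S))) fromℕ-M ⟩
      ½ * (energy p + energy (suc p)) + 1ℚ * (½ * (1ℚ + (fromℕ p + fromℕ p)) * (x₀ * x₀) + - (x₀ * S))
        ≡⟨ regroup (fromℕ p) (T 0) R R′ x₀ S ⟩
      ½ * (1ℚ + (fromℕ p + fromℕ p)) * (x₀ * x₀ + T 0) + - (x₀ * S) + (R + R′)
        ≡⟨ cong₂ (λ m r → ½ * m * (x₀ * x₀ + T 0) + - (x₀ * S) + r) (sym fromℕ-M) (ramp-pair p (T± ∘ suc)) ⟩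
      closedForm ∎
      where
      open ≡-Reasoning
      α = alt p
      β = alt (suc p)
      R = ramp p (T± ∘ suc)
      R′ = ramp (suc p) (T± ∘ suc)
      fromℕ-M : fromℕ M ≡ 1ℚ + (fromℕ p + fromℕ p)
      fromℕ-M = cong (1ℚ +_) (fromℕ-+ p p)
      factor : ∀ e e′ α β x s m →
               ½ * (e + - (α * x + α * x) * (α * s) + m * (α * x * (α * x)))
                 + ½ * (e′ + - (β * x + β * x) * (β * s) + m * (β * x * (β * x)))
               ≡ ½ * (e + e′) + (α * α + β * β) * (½ * m * (x * x) + - (x * s))
      factor = solve-∀ ℚ-ring
      regroup : ∀ f t r r′ x s →
                ½ * ((f * t + (r + r)) + ((1ℚ + f) * t + (r′ + r′))) + 1ℚ * (½ * (1ℚ + (f + f)) * (x * x) + - (x * s))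
                ≡ ½ * (1ℚ + (f + f)) * (x * x + t) + - (x * s) + (r + r′)
      regroup = solve-∀ ℚ-ring

    sos-nonneg : 0ℚ ℚ.≤ ½ * offsetSquares p + ½ * offsetSquares (suc p)
    sos-nonneg = ℚP.+-mono-≤ (½*-nonneg (squares-nonneg p)) (½*-nonneg (squares-nonneg (suc p)))
      where
      squares-nonneg : ∀ N → 0ℚ ℚ.≤ offsetSquares N
      squares-nonneg N = ∑-nonneg M _ (λ i → square-nonneg (W N i + - (alt N * x₀)))

  L-psd : PositiveSemidefinite L
  L-psd = L-symmetric , λ x → subst (0ℚ ℚ.≤_) (trans (sos≡closedForm x) (sym (quadForm≡closedForm x))) (sos-nonneg x)

theorem3 : (n : ℕ) → 4 ≤ n → 2 ∣ n → PositiveSemidefinite (specialLaplacian n)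
theorem3 n 4≤n (divides zero n≡0) with () ← subst (4 ≤_) n≡0 4≤n
theorem3 n _ (divides (suc p) n≡[1+p]*2) = subst (PositiveSemidefinite ∘ specialLaplacian) (sym n≡2+p+p) (Wheel.L-psd p)
  where
  n≡2+p+p : n ≡ suc (suc (p ℕ.+ p))
  n≡2+p+p = trans n≡[1+p]*2 ([1+p]*2≡2+p+p p)
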